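{- Let $M=(X,d)$ be a metric space, let $P=\{P_i\}_{i=1}^t$ be a temporal-sampling of $M$, and let $\chi,\delta\ge0$. If pseudo-ultrametric spaces $U_i=(P_i,\mu_i)$, $i\in[t]$, and correspondences $\mathcal{C}_i$, $i\in[t-1]$, form a local $(\chi,\delta)$-temporal hierarchical clustering of $P$, then they also form a generalized $(\chi,2\chi+2\delta)$-temporal hierarchical clustering of the sequence of metric spaces $\{M[P_i]\}_{i=1}^t$; in particular $\mathrm{dis}(\mu_i,\mu_{i+1};\mathcal{C}_i)\le 2\chi+2\delta$ for all $i\in[t-1]$.
   Context: A temporal-sampling of $M=(X,d)$ is a sequence of finite, non-empty subsets $P_1,\dots,P_t$ of $X$. $M[Q]=(Q,d|_Q)$ is the restriction of $M$ to $Q$. A pseudo-ultrametric is a pseudometric $\mu$ with $\mu(x,z)\le\max\{\mu(x,y),\mu(y,z)\}$ for all $x,y,z$. For pseudometrics $d_U,d_W$ on the same finite set $Y$, $L^\infty((Y,d_U),(Y,d_W))=\max_{p,p'\in Y}|d_U(p,p')-d_W(p,p')|$. A correspondence between sets $A,B$ is a relation $\mathcal{C}\subseteq A\times B$ whose projections onto $A$ and onto $B$ are surjective; $\mathrm{corr}(A,B)$ is the set of these. For pseudometrics $\mu_1$ on $A$ and $\mu_2$ on $B$, $\mathrm{dis}(\mu_1,\mu_2;\mathcal{C})=\max_{(u,v),(u',v')\in\mathcal{C}}|\mu_1(u,u')-\mu_2(v,v')|$. A local $(\chi,\delta)$-temporal hierarchical clustering of $P$: pseudo-ultrametric spaces $U_i=(P_i,\mu_i)$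 with $L^\infty(M[P_i],U_i)\le\chi$ for all $i\in[t]$, and $\mathcal{C}_i\in\mathrm{corr}(P_i,P_{i+1})$ with $\max_{(u,v)\in\mathcal{C}_i}d(u,v)\le\delta$ for all $i\in[t-1]$. A generalized $(\chi,\rho)$-temporal hierarchical clustering of metric spaces $M_i=(P_i,\cdot)$: pseudo-ultrametric spaces $U_i=(P_i,\mu_i)$ with $L^\infty(M_i,U_i)\le\chi$ for all $i$, and $\mathcal{C}_i\in\mathrm{corr}(P_i,P_{i+1})$ with $\mathrm{dis}(\mu_i,\mu_{i+1};\mathcal{C}_i)\le\rho$ for all $i\in[t-1]$. -}

module Defs where

open import Level using (0ℓ)
open import Data.Nat using (ℕ; suc)
open import Data.Fin using (Fin; inject₁) renaming (suc to fsuc)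
open import Data.List using (List; [])
open import Data.List.Membership.Propositional using (_∈_)
open import Data.Product using (Σ; ∃; ∃-syntax; _×_; _,_)
open import Relation.Binary.PropositionalEquality using (_≡_; _≢_)
open import Relation.Binary.Definitions using (Decidable)
open import Relation.Binary.Structures using (IsTotalOrder)
open import Relation.Nullary using (yes; no)
open import Algebra.Structures using (IsCommutativeRing)

-- The real numbers, axiomatised as a Dedekind-complete ordered field.
-- (agda-stdlib has no reals; every such structure is isomorphic to ℝ,
-- so quantifying over all of them is faithful to a statement about ℝ.)

record RealField : Set₁ where
  infixl 6 _+_ _-_
  infixl 7 _*_
  infix  4 _≤_
  field
    Carrier : Set
    _+_ _*_ : Carrier → Carrier → Carrier
    -_      : Carrier → Carrier
    0# 1#   : Carrier
    _≤_     : Carrier → Carrier → Set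
    isCommutativeRing : IsCommutativeRing _≡_ _+_ _*_ -_ 0# 1#
    isTotalOrder      : IsTotalOrder _≡_ _≤_
    _≤?_              : Decidable _≤_
    0≢1     : 0# ≢ 1#
    inverse : ∀ x → x ≢ 0# → ∃[ y ] (x * y ≡ 1#)
    +-mono-≤ : ∀ {x y} z → x ≤ y → x + z ≤ y + z
    *-nonneg : ∀ {x y} → 0# ≤ x → 0# ≤ y → 0# ≤ x * y
    sup : (S : Carrier → Set) → ∃[ x ] S x →
          ∃[ b ] (∀ x → S x → x ≤ b) →
          ∃[ s ] ((∀ x → S x → x ≤ s) × (∀ b → (∀ x → S x → x ≤ b) → s ≤ b))

  _-_ : Carrier → Carrier → Carrier
  x - y = x + (- y)

  max : Carrier → Carrier → Carrier
  max x y with x ≤? y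
  ... | yes _ = y
  ... | no  _ = x

  ∣_∣ : Carrier → Carrier
  ∣ x ∣ = max x (- x)

  2# : Carrier
  2# = 1# + 1#

module _ (ℝ : RealField) where
  open RealField ℝ

  record IsMetric {X : Set} (d : X → X → Carrier) : Set where
    field
      nonneg   : ∀ x y → 0# ≤ d x y
      zero⇔eq₁ : ∀ x y → d x y ≡ 0# → x ≡ y
      zero⇔eq₂ : ∀ x → d x x ≡ 0#
      sym      : ∀ x y → d x y ≡ d y x
      triangle : ∀ x y z → d x z ≤ d x y + d y z

  -- A finite subset Q of X is given by a list enumerating it.
  NonEmpty : {X : Set} → List X → Set
  NonEmpty xs = xs ≢ []

  IsTemporalSampling : {X : Set} {n : ℕ} → (Fin (suc n) → List X) → Set
  IsTemporalSampling P = ∀ i → NonEmpty (P i)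

  -- μ is a pseudo-ultrametric on the finite set Q (only values on Q × Q matter).
  record IsPseudoUltrametricOn {X : Set} (Q : List X) (μ : X → X → Carrier) : Set where
    field
      nonneg   : ∀ {x y} → x ∈ Q → y ∈ Q → 0# ≤ μ x y
      refl0    : ∀ {x} → x ∈ Q → μ x x ≡ 0#
      sym      : ∀ {x y} → x ∈ Q → y ∈ Q → μ x y ≡ μ y x
      triangle : ∀ {x y z} → x ∈ Q → y ∈ Q → z ∈ Q → μ x z ≤ μ x y + μ y z
      ultra    : ∀ {x y z} → x ∈ Q → y ∈ Q → z ∈ Q → μ x z ≤ max (μ x y) (μ y z)

  L∞≤ : {X : Set} → List X → (X → X → Carrier) → (X → X → Carrier) → Carrier → Set
  L∞≤ Q d₁ d₂ c = ∀ {p p'} → p ∈ Q → p' ∈ Q → ∣ d₁ p p' - d₂ p p' ∣ ≤ c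

  record IsCorrespondence {X : Set} (A B : List X) (C : X → X → Set) : Set where
    field
      ⊆A×B  : ∀ {u v} → C u v → (u ∈ A) × (v ∈ B)
      surjA : ∀ {u} → u ∈ A → ∃[ v ] C u v
      surjB : ∀ {v} → v ∈ B → ∃[ u ] C u v

  dis≤ : {X : Set} → (X → X → Carrier) → (X → X → Carrier) → (X → X → Set) → Carrier → Set
  dis≤ μ₁ μ₂ C c = ∀ {u v u' v'} → C u v → C u' v' → ∣ μ₁ u u' - μ₂ v v' ∣ ≤ c

  record IsLocalTHC {X : Set} (d : X → X → Carrier) {n : ℕ}
         (P : Fin (suc n) → List X) (χ δ : Carrier)
         (μ : Fin (suc n) → X → X → Carrier)
         (C : Fin n → X → X → Set) : Set where
    field
      ultrametric : ∀ i → IsPseudoUltrametricOn (P i) (μ i)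
      close       : ∀ i → L∞≤ (P i) d (μ i) χ
      corr        : ∀ i → IsCorrespondence (P (inject₁ i)) (P (fsuc i)) (C i)
      shift       : ∀ i {u v} → C i u v → d u v ≤ δ

  record IsGeneralizedTHC {X : Set} {n : ℕ}
         (P : Fin (suc n) → List X) (dᵢ : Fin (suc n) → X → X → Carrier)
         (χ ρ : Carrier)
         (μ : Fin (suc n) → X → X → Carrier)
         (C : Fin n → X → X → Set) : Set where
    field
      ultrametric : ∀ i → IsPseudoUltrametricOn (P i) (μ i)
      close       : ∀ i → L∞≤ (P i) (dᵢ i) (μ i) χ
      corr        : ∀ i → IsCorrespondence (P (inject₁ i)) (P (fsuc i)) (C i)
      distortion  : ∀ i → dis≤ (μ (inject₁ i)) (μ (fsuc i)) (C i) ρ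

-- For (u , v) and (u' , v') in Cᵢ, walk from μᵢ(u,u') to d(u,u') (error at most χ),
-- then to d(v,v') (error at most d(u,v) + d(u',v') ≤ 2δ, by the triangle inequality
-- in both directions), then to μᵢ₊₁(v,v') (error at most χ).  The other three
-- conditions are literally shared by the two notions.
module Submission where

open import Defs
open import Data.Nat using (ℕ; suc)
open import Data.Fin using (Fin; inject₁) renaming (suc to fsuc)
open import Data.List using (List)
open import Data.Product using (proj₁; proj₂)
open import Data.Sum using (inj₁; inj₂)
open import Relation.Nullary using (yes; no; contradiction)
open import Relation.Binary.PropositionalEquality as ≡ using (_≡_; cong)
open import Relation.Binary.Bundles using (Poset)
open import Relation.Binary.Structures using (IsTotalOrder)
open import Algebra.Bundles using (CommutativeRing)
open import Algebra.Structures using (IsCommutativeRing)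
import Algebra.Properties.AbelianGroup as AbelianGroupProperties
import Algebra.Properties.CommutativeSemigroup as CommutativeSemigroupProperties
import Relation.Binary.Reasoning.PartialOrder as PosetReasoning

module OrderedField (ℝ : RealField) where
  open RealField ℝ

  commutativeRing : CommutativeRing _ _
  commutativeRing = record { isCommutativeRing = isCommutativeRing }

  open IsCommutativeRing isCommutativeRing using (+-comm; +-assoc; distribʳ; *-identityˡ)
  open IsTotalOrder isTotalOrder using (total) renaming (refl to ≤-refl; trans to ≤-trans)
  open AbelianGroupProperties (CommutativeRing.+-abelianGroup commutativeRing)
    using (⁻¹-anti-homo‿-; ⁻¹-∙-comm; //-rightDividesˡ; xyx⁻¹≈y)
  open CommutativeSemigroupProperties (CommutativeRing.+-commutativeSemigroup commutativeRing)
    using (x∙yz≈y∙xz; xy∙z≈xz∙y)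

  poset : Poset _ _ _
  poset = record { isPartialOrder = IsTotalOrder.isPartialOrder isTotalOrder }

  open PosetReasoning poset

  +-monoʳ-≤ : ∀ z {x y} → x ≤ y → z + x ≤ z + y
  +-monoʳ-≤ z {x} {y} x≤y = begin
    z + x ≡⟨ +-comm z x ⟩
    x + z ≤⟨ +-mono-≤ z x≤y ⟩
    y + z ≡⟨ +-comm y z ⟩
    z + y ∎

  +-mono-≤₂ : ∀ {x x' y y'} → x ≤ x' → y ≤ y' → x + y ≤ x' + y'
  +-mono-≤₂ {x' = x'} {y} x≤x' y≤y' = ≤-trans (+-mono-≤ y x≤x') (+-monoʳ-≤ x' y≤y')

  x≤y+z⇒x-y≤z : ∀ {x y z} → x ≤ y + z → x - y ≤ z
  x≤y+z⇒x-y≤z {x} {y} {z} x≤y+z = begin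
    x - y       ≤⟨ +-mono-≤ (- y) x≤y+z ⟩
    y + z - y   ≡⟨ xyx⁻¹≈y y z ⟩
    z           ∎

  x-y+y-z≡x-z : ∀ x y z → (x - y) + (y - z) ≡ x - z
  x-y+y-z≡x-z x y z = ≡.trans (≡.sym (+-assoc (x - y) y (- z)))
                              (cong (_- z) (//-rightDividesˡ y x))

  -[x-y]≡y-x : ∀ x y → - (x - y) ≡ y - x
  -[x-y]≡y-x = ⁻¹-anti-homo‿-

  2*x≡x+x : ∀ x → 2# * x ≡ x + x
  2*x≡x+x x = ≡.trans (distribʳ x 1# 1#) (≡.cong₂ _+_ (*-identityˡ x) (*-identityˡ x))

  x≤∣x∣ : ∀ x → x ≤ ∣ x ∣
  x≤∣x∣ x with x ≤? (- x)
  ... | yes x≤-x = x≤-x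
  ... | no  _    = ≤-refl

  -x≤∣x∣ : ∀ x → - x ≤ ∣ x ∣
  -x≤∣x∣ x with x ≤? (- x)
  ... | yes _    = ≤-refl
  ... | no  x≰-x with total x (- x)
  ...   | inj₁ x≤-x = contradiction x≤-x x≰-x
  ...   | inj₂ -x≤x = -x≤x

  ∣x∣≤c : ∀ {x c} → x ≤ c → - x ≤ c → ∣ x ∣ ≤ c
  ∣x∣≤c {x} x≤c -x≤c with x ≤? (- x)
  ... | yes _ = -x≤c
  ... | no  _ = x≤c

  ∣x-y∣≤⇒∣y-x∣≤ : ∀ {x y c} → ∣ x - y ∣ ≤ c → ∣ y - x ∣ ≤ c
  ∣x-y∣≤⇒∣y-x∣≤ {x} {y} {c} ∣x-y∣≤c = ∣x∣≤c
    (begin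
      y - x        ≡⟨ ≡.sym (-[x-y]≡y-x x y) ⟩
      - (x - y)    ≤⟨ -x≤∣x∣ (x - y) ⟩
      ∣ x - y ∣    ≤⟨ ∣x-y∣≤c ⟩
      c            ∎)
    (begin
      - (y - x)    ≡⟨ -[x-y]≡y-x y x ⟩
      x - y        ≤⟨ x≤∣x∣ (x - y) ⟩
      ∣ x - y ∣    ≤⟨ ∣x-y∣≤c ⟩
      c            ∎)

  ∣x-z∣≤ : ∀ {x y z α β} → ∣ x - y ∣ ≤ α → ∣ y - z ∣ ≤ β → ∣ x - z ∣ ≤ α + β
  ∣x-z∣≤ {x} {y} {z} {α} {β} ∣x-y∣≤α ∣y-z∣≤β = ∣x∣≤c
    (begin
      x - z                 ≡⟨ ≡.sym (x-y+y-z≡x-z x y z) ⟩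
      (x - y) + (y - z)     ≤⟨ +-mono-≤₂ (≤-trans (x≤∣x∣ _) ∣x-y∣≤α) (≤-trans (x≤∣x∣ _) ∣y-z∣≤β) ⟩
      α + β                 ∎)
    (begin
      - (x - z)             ≡⟨ cong -_ (≡.sym (x-y+y-z≡x-z x y z)) ⟩
      - ((x - y) + (y - z)) ≡⟨ ≡.sym (⁻¹-∙-comm (x - y) (y - z)) ⟩
      - (x - y) + - (y - z) ≤⟨ +-mono-≤₂ (≤-trans (-x≤∣x∣ _) ∣x-y∣≤α) (≤-trans (-x≤∣x∣ _) ∣y-z∣≤β) ⟩
      α + β                 ∎)

  χ+[δ+δ]+χ≡2χ+2δ : ∀ χ δ → (χ + (δ + δ)) + χ ≡ 2# * χ + 2# * δ
  χ+[δ+δ]+χ≡2χ+2δ χ δ = ≡.trans (xy∙z≈xz∙y χ (δ + δ) χ)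
                                (≡.sym (≡.cong₂ _+_ (2*x≡x+x χ) (2*x≡x+x δ)))

  module Metric {X : Set} {d : X → X → Carrier} (isMetric : IsMetric ℝ d) where
    open IsMetric isMetric

    d-d≤ : ∀ u u' v v' → d u u' - d v v' ≤ d u v + d u' v'
    d-d≤ u u' v v' = x≤y+z⇒x-y≤z (begin
      d u u'                      ≤⟨ triangle u v u' ⟩
      d u v + d v u'              ≤⟨ +-monoʳ-≤ (d u v) (triangle v v' u') ⟩
      d u v + (d v v' + d v' u')  ≡⟨ x∙yz≈y∙xz (d u v) (d v v') (d v' u') ⟩
      d v v' + (d u v + d v' u')  ≡⟨ cong (λ t → d v v' + (d u v + t)) (sym v' u') ⟩
      d v v' + (d u v + d u' v')  ∎)

    ∣d-d∣≤ : ∀ u u' v v' → ∣ d u u' - d v v' ∣ ≤ d u v + d u' v'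
    ∣d-d∣≤ u u' v v' = ∣x∣≤c (d-d≤ u u' v v') (begin
      - (d u u' - d v v')  ≡⟨ -[x-y]≡y-x (d u u') (d v v') ⟩
      d v v' - d u u'      ≤⟨ d-d≤ v v' u u' ⟩
      d v u + d v' u'      ≡⟨ ≡.cong₂ _+_ (sym v u) (sym v' u') ⟩
      d u v + d u' v'      ∎)

module _ (ℝ : RealField) where
  open RealField ℝ
  open OrderedField ℝ
  open IsTotalOrder isTotalOrder using () renaming (trans to ≤-trans)

  module _ {X : Set} {d : X → X → Carrier} (isMetric : IsMetric ℝ d)
           {n : ℕ} {P : Fin (suc n) → List X} {χ δ : Carrier}
           {μ : Fin (suc n) → X → X → Carrier} {C : Fin n → X → X → Set}
           (local : IsLocalTHC ℝ d P χ δ μ C) where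
    open IsLocalTHC local
    open Metric isMetric

    local⇒distortion≤ : ∀ i → dis≤ ℝ (μ (inject₁ i)) (μ (fsuc i)) (C i) (2# * χ + 2# * δ)
    local⇒distortion≤ i {u} {v} {u'} {v'} uCv u'Cv' =
      ≡.subst (∣ μ (inject₁ i) u u' - μ (fsuc i) v v' ∣ ≤_) (χ+[δ+δ]+χ≡2χ+2δ χ δ)
        (∣x-z∣≤ (∣x-z∣≤ ∣μ-d∣≤χ ∣d-d∣≤δ+δ) ∣d-μ∣≤χ)
      where
      open IsCorrespondence (corr i) using (⊆A×B)
      ∣μ-d∣≤χ : ∣ μ (inject₁ i) u u' - d u u' ∣ ≤ χ
      ∣μ-d∣≤χ = ∣x-y∣≤⇒∣y-x∣≤ (close (inject₁ i) (proj₁ (⊆A×B uCv)) (proj₁ (⊆A×B u'Cv')))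
      ∣d-d∣≤δ+δ : ∣ d u u' - d v v' ∣ ≤ δ + δ
      ∣d-d∣≤δ+δ = ≤-trans (∣d-d∣≤ u u' v v') (+-mono-≤₂ (shift i uCv) (shift i u'Cv'))
      ∣d-μ∣≤χ : ∣ d v v' - μ (fsuc i) v v' ∣ ≤ χ
      ∣d-μ∣≤χ = close (fsuc i) (proj₂ (⊆A×B uCv)) (proj₂ (⊆A×B u'Cv'))

lemma12 : (ℝ : RealField) → let open RealField ℝ in
    {X : Set} (d : X → X → Carrier) → IsMetric ℝ d →
    {n : ℕ} (P : Fin (suc n) → List X) → IsTemporalSampling ℝ P →
    (χ δ : Carrier) → 0# ≤ χ → 0# ≤ δ →
    (μ : Fin (suc n) → X → X → Carrier) (C : Fin n → X → X → Set) →
    IsLocalTHC ℝ d P χ δ μ C →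
    IsGeneralizedTHC ℝ P (λ _ → d) χ (2# * χ + 2# * δ) μ C
lemma12 ℝ d isMetric P _ χ δ _ _ μ C local = record
  { ultrametric = ultrametric
  ; close       = close
  ; corr        = corr
  ; distortion  = local⇒distortion≤ ℝ isMetric local
  }
  where open IsLocalTHC local
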